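{- Let $n\ge 3$ and let $J_\pm(n,3,-1)$ be the graph whose vertex set consists of all vectors $v\in\{ -1,0,1\}^n$ with exactly $3$ nonzero coordinates, two vertices being adjacent if and only if their standard scalar product equals $-1$. Let $I$ be an independent set in $J_\pm(n,3,-1)$, and call a coordinate $i\in\{1,\dots,n\}$ diverse (with respect to $I$) if there exist $u,w\in I$ with $u_i=1$ and $w_i=-1$. If exactly $t$ coordinates are diverse, then \[ |I|\le 8t(n-2)+\binom{n-t}{3}. \]
   Context: An independent set in a graph is a set of vertices no two of which are adjacent. -}

module Defs where

open import Data.Nat using (ℕ)
open import Data.Integer as ℤ using (ℤ; 0ℤ; 1ℤ; -1ℤ)
open import Data.Fin using (Fin)
open import Data.Vec using (Vec; foldr; zipWith; lookup; count)
open import Data.Vec.Relation.Unary.All using (All)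
open import Data.List using (List)
open import Data.List.Membership.Propositional using (_∈_)
open import Data.List.Relation.Unary.Unique.Propositional using (Unique)
open import Data.Product using (_×_; ∃-syntax)
open import Data.Sum using (_⊎_)
open import Relation.Nullary using (¬_; ¬?)
open import Relation.Binary.PropositionalEquality using (_≡_)

IsTrit : ℤ → Set
IsTrit x = x ≡ -1ℤ ⊎ x ≡ 0ℤ ⊎ x ≡ 1ℤ

nonzeros : ∀ {n} → Vec ℤ n → ℕ
nonzeros = count (λ x → ¬? (x ℤ.≟ 0ℤ))

IsVertex : ∀ {n} → Vec ℤ n → Set
IsVertex v = All IsTrit v × nonzeros v ≡ 3

dot : ∀ {n} → Vec ℤ n → Vec ℤ n → ℤ
dot u v = foldr _ ℤ._+_ 0ℤ (zipWith ℤ._*_ u v)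

Adjacent : ∀ {n} → Vec ℤ n → Vec ℤ n → Set
Adjacent u v = dot u v ≡ -1ℤ

IsIndependentSet : ∀ {n} → List (Vec ℤ n) → Set
IsIndependentSet {n} I =
  Unique I × (∀ {v} → v ∈ I → IsVertex v)
  × (∀ {u w} → u ∈ I → w ∈ I → ¬ Adjacent u w)

Diverse : ∀ {n} → List (Vec ℤ n) → Fin n → Set
Diverse I i = ∃[ u ] ∃[ w ] (u ∈ I × w ∈ I × lookup u i ≡ 1ℤ × lookup w i ≡ -1ℤ)

-- Split I into the vectors that are nonzero at some diverse coordinate and those vanishing on all
-- diverse coordinates.  Fix a diverse coordinate i and a sign s, and take r ∈ I with rᵢ = -s.  After
-- deleting coordinate i, the vectors x ∈ I with xᵢ = s become weight-2 trit vectors with pairwise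
-- products ≠ -2 (as x·y ≠ -1), each meeting the two-point support of r (as x·r ≠ -1).  Multiplying by
-- the entry at one support point turns those meeting it into distinct weight-1 vectors, at most
-- 2(n-2) of them; so at most 8(n-2) vectors of I are nonzero at i.  A vector vanishing on the diverse
-- coordinates can take only one sign at each other coordinate, so it is determined by its support,
-- a 3-subset of the n - t non-diverse coordinates.

module Submission where

open import Defs
import Algebra.Properties.CommutativeMonoid.Sum as MonoidSum
import Algebra.Properties.Semiring.Sum as SemiringSum
open import Data.Empty using (⊥-elim)
open import Data.Fin using (Fin; zero; suc; punchIn; punchOut)
open import Data.Fin.Properties using (punchIn-punchOut; any?) renaming (_≟_ to _≟ᶠ_)
open import Data.Fin.Subset using (Subset; ∣_∣; inside; outside) renaming (_∈_ to _∈ₛ_; ⊥ to ∅)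
open import Data.Fin.Subset.Properties using (∣p∣≤n; ∣⊥∣≡0; ∉⊥)
open import Data.Integer as ℤ using (ℤ; +_; -[1+_]; 0ℤ; 1ℤ; -1ℤ)
import Data.Integer.Properties as ℤP
open import Data.List as List using (List; []; _∷_; length; filter)
open import Data.List.Membership.Propositional using (_∈_)
open import Data.List.Membership.Propositional.Properties using (∈-filter⁻; ∈-map⁺; ∈-map⁻)
open import Data.List.Properties using (length-map)
open import Data.List.Relation.Binary.Subset.Propositional using (_⊆_)
open import Data.List.Relation.Binary.Subset.Propositional.Properties using (filter-⊆)
open import Data.List.Relation.Unary.Any using (here; there)
open import Data.List.Relation.Unary.All using (_∷_)
open import Data.List.Relation.Unary.AllPairs using (_∷_)
open import Data.List.Relation.Unary.Unique.Propositional using (Unique)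
import Data.List.Relation.Unary.Unique.Propositional.Properties as Unique
open import Data.Nat using (ℕ; zero; suc; _+_; _*_; _∸_; _≤_; z≤n; s≤s)
open import Data.Nat.Combinatorics using (_C_; nC1≡n; nCk+nC[k+1]≡[n+1]C[k+1])
import Data.Nat.Properties as ℕP
open import Data.Product using (_×_; _,_; proj₁; proj₂; ∃-syntax; ∃₂)
open import Data.Sum using (_⊎_; inj₁; inj₂)
open import Data.Vec as Vec using (Vec; []; _∷_; lookup)
open import Data.Vec.Properties using (tabulate∘lookup; tabulate-cong)
open import Data.Vec.Relation.Unary.All.Properties using (lookup⁺)
open import Data.Vec.Functional as Vector using (Vector; removeAt)
open import Data.Vec.Functional.Properties using (removeAt-punchOut)
open import Function using (_∘_)
open import Relation.Binary.PropositionalEquality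
open import Relation.Nullary using (¬_; yes; no)
open import Relation.Unary using (Decidable)
open import Relation.Unary.Properties using (∁?)

module ℤΣ = SemiringSum ℤP.+-*-semiring
module ℕΣ = MonoidSum ℕP.+-0-commutativeMonoid


isNonzero : ℤ → ℕ
isNonzero (+ zero)  = 0
isNonzero (+ suc _) = 1
isNonzero -[1+ _ ]  = 1

isNonzero-≢0 : ∀ {x} → x ≢ 0ℤ → isNonzero x ≡ 1
isNonzero-≢0 {+ zero}    x≢0 = ⊥-elim (x≢0 refl)
isNonzero-≢0 {+ suc _}   _   = refl
isNonzero-≢0 { -[1+ _ ]} _   = refl

isNonzero≡0⇒≡0 : ∀ {x} → isNonzero x ≡ 0 → x ≡ 0ℤ
isNonzero≡0⇒≡0 {+ zero} _ = refl

isNonzero-neg : ∀ x → isNonzero (ℤ.- x) ≡ isNonzero x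
isNonzero-neg (+ zero)  = refl
isNonzero-neg (+ suc _) = refl
isNonzero-neg -[1+ _ ]  = refl

Trits : ∀ {N} → Vector ℤ N → Set
Trits v = ∀ j → IsTrit (v j)

trit-square : ∀ {x} → IsTrit x → x ℤ.* x ≡ + isNonzero x
trit-square (inj₁ refl)        = refl
trit-square (inj₂ (inj₁ refl)) = refl
trit-square (inj₂ (inj₂ refl)) = refl

trit-* : ∀ {x y} → IsTrit x → IsTrit y → IsTrit (x ℤ.* y)
trit-* (inj₁ refl)        (inj₁ refl)        = inj₂ (inj₂ refl)
trit-* (inj₁ refl)        (inj₂ (inj₁ refl)) = inj₂ (inj₁ refl)
trit-* (inj₁ refl)        (inj₂ (inj₂ refl)) = inj₁ refl
trit-* (inj₂ (inj₁ refl)) _                  = inj₂ (inj₁ refl)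
trit-* (inj₂ (inj₂ refl)) (inj₁ refl)        = inj₁ refl
trit-* (inj₂ (inj₂ refl)) (inj₂ (inj₁ refl)) = inj₂ (inj₁ refl)
trit-* (inj₂ (inj₂ refl)) (inj₂ (inj₂ refl)) = inj₂ (inj₂ refl)

trit≢0,1⇒≡-1 : ∀ {x} → IsTrit x → x ≢ 0ℤ → x ≢ 1ℤ → x ≡ -1ℤ
trit≢0,1⇒≡-1 (inj₁ x≡-1)        _   _   = x≡-1
trit≢0,1⇒≡-1 (inj₂ (inj₁ x≡0)) x≢0 _   = ⊥-elim (x≢0 x≡0)
trit≢0,1⇒≡-1 (inj₂ (inj₂ x≡1)) _   x≢1 = ⊥-elim (x≢1 x≡1)

isNonzero-*-unit : ∀ {s} x → IsTrit s → s ≢ 0ℤ → isNonzero (s ℤ.* x) ≡ isNonzero x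
isNonzero-*-unit x (inj₁ refl)        _   = trans (cong isNonzero (ℤP.-1*i≡-i x)) (isNonzero-neg x)
isNonzero-*-unit x (inj₂ (inj₁ refl)) s≢0 = ⊥-elim (s≢0 refl)
isNonzero-*-unit x (inj₂ (inj₂ refl)) _   = cong isNonzero (ℤP.*-identityˡ x)

unit-product : ∀ {s t} → IsTrit s → IsTrit t → s ≢ 0ℤ → t ≢ 0ℤ → s ≡ t ⊎ s ℤ.* t ≡ -1ℤ
unit-product (inj₁ refl)        (inj₁ refl)        _   _   = inj₁ refl
unit-product (inj₁ refl)        (inj₂ (inj₂ refl)) _   _   = inj₂ refl
unit-product (inj₂ (inj₂ refl)) (inj₁ refl)        _   _   = inj₂ refl
unit-product (inj₂ (inj₂ refl)) (inj₂ (inj₂ refl)) _   _   = inj₁ refl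
unit-product (inj₂ (inj₁ refl)) _                  s≢0 _   = ⊥-elim (s≢0 refl)
unit-product _                  (inj₂ (inj₁ refl)) _   t≢0 = ⊥-elim (t≢0 refl)

sign-agree : ∀ {s t} → IsTrit s → IsTrit t → s ≢ 0ℤ → t ≢ 0ℤ →
             (s ≡ 1ℤ → t ≢ -1ℤ) → (t ≡ 1ℤ → s ≢ -1ℤ) → s ≡ t
sign-agree (inj₁ refl)        (inj₁ refl)        _   _   _ _ = refl
sign-agree (inj₁ refl)        (inj₂ (inj₂ refl)) _   _   _ c = ⊥-elim (c refl refl)
sign-agree (inj₂ (inj₂ refl)) (inj₁ refl)        _   _   c _ = ⊥-elim (c refl refl)
sign-agree (inj₂ (inj₂ refl)) (inj₂ (inj₂ refl)) _   _   _ _ = refl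
sign-agree (inj₂ (inj₁ refl)) _                  s≢0 _   _ _ = ⊥-elim (s≢0 refl)
sign-agree _                  (inj₂ (inj₁ refl)) _   t≢0 _ _ = ⊥-elim (t≢0 refl)

trit≢0⇒square≡1 : ∀ {x} → IsTrit x → x ≢ 0ℤ → x ℤ.* x ≡ 1ℤ
trit≢0⇒square≡1 t x≢0 = trans (trit-square t) (cong +_ (isNonzero-≢0 x≢0))

*≡⇒≢0 : ∀ {a b c} → c ≢ 0ℤ → a ℤ.* b ≡ c → a ≢ 0ℤ × b ≢ 0ℤ
*≡⇒≢0 {a} {b} c≢0 ab≡c =
  (λ a≡0 → c≢0 (trans (sym ab≡c) (trans (cong (ℤ._* b) a≡0) (ℤP.*-zeroˡ b)))) ,
  (λ b≡0 → c≢0 (trans (sym ab≡c) (trans (cong (a ℤ.*_) b≡0) (ℤP.*-zeroʳ a))))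

*-cancel-unit : ∀ s t a b → s ℤ.* s ≡ 1ℤ → s ℤ.* a ≡ t ℤ.* b → a ≡ (s ℤ.* t) ℤ.* b
*-cancel-unit s t a b ss≡1 sa≡tb = begin
  a                   ≡⟨ ℤP.*-identityˡ a ⟨
  1ℤ ℤ.* a            ≡⟨ cong (ℤ._* a) ss≡1 ⟨
  (s ℤ.* s) ℤ.* a     ≡⟨ ℤP.*-assoc s s a ⟩
  s ℤ.* (s ℤ.* a)     ≡⟨ cong (s ℤ.*_) sa≡tb ⟩
  s ℤ.* (t ℤ.* b)     ≡⟨ ℤP.*-assoc s t b ⟨
  (s ℤ.* t) ℤ.* b     ∎
  where open ≡-Reasoning

weight : ∀ {N} → Vector ℤ N → ℕ
weight v = ℕΣ.sum (isNonzero ∘ v)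

weight-removeAt : ∀ {N} (v : Vector ℤ (suc N)) i → weight v ≡ isNonzero (v i) + weight (removeAt v i)
weight-removeAt v i = ℕΣ.sum-remove {i = i} (isNonzero ∘ v)

weight-removeAt-≡0 : ∀ {N} (v : Vector ℤ (suc N)) i → v i ≡ 0ℤ → weight (removeAt v i) ≡ weight v
weight-removeAt-≡0 v i vᵢ≡0 =
  sym (trans (weight-removeAt v i) (cong (λ x → isNonzero x + weight (removeAt v i)) vᵢ≡0))

weight-removeAt-≢0 : ∀ {N k} (v : Vector ℤ (suc N)) i → v i ≢ 0ℤ → weight v ≡ suc k →
                     weight (removeAt v i) ≡ k
weight-removeAt-≢0 {k = k} v i vᵢ≢0 w≡ = ℕP.suc-injective (begin
  suc (weight (removeAt v i))              ≡⟨ cong (_+ weight (removeAt v i)) (isNonzero-≢0 vᵢ≢0) ⟨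
  isNonzero (v i) + weight (removeAt v i)  ≡⟨ weight-removeAt v i ⟨
  weight v                                 ≡⟨ w≡ ⟩
  suc k                                    ∎)
  where open ≡-Reasoning

weight≡0⇒≡0 : ∀ {N} (v : Vector ℤ N) → weight v ≡ 0 → ∀ j → v j ≡ 0ℤ
weight≡0⇒≡0 v w≡0 zero    = isNonzero≡0⇒≡0 (ℕP.m+n≡0⇒m≡0 _ w≡0)
weight≡0⇒≡0 v w≡0 (suc j) = weight≡0⇒≡0 (Vector.tail v) (ℕP.m+n≡0⇒n≡0 (isNonzero (v zero)) w≡0) j

weight≡suc⇒∃≢0 : ∀ {N k} (v : Vector ℤ N) → weight v ≡ suc k → ∃[ j ] v j ≢ 0ℤ
weight≡suc⇒∃≢0 {zero}  v ()
weight≡suc⇒∃≢0 {suc N} v w≡ with v zero ℤ.≟ 0ℤ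
... | no v₀≢0  = zero , v₀≢0
... | yes v₀≡0 with j , vⱼ≢0 ← weight≡suc⇒∃≢0 (Vector.tail v) (trans (weight-removeAt-≡0 v zero v₀≡0) w≡)
  = suc j , vⱼ≢0

weight≡1⇒support-unique : ∀ {N} {v : Vector ℤ N} {i j} → weight v ≡ 1 → v i ≢ 0ℤ → v j ≢ 0ℤ → i ≡ j
weight≡1⇒support-unique {suc N} {v} {i} {j} w≡1 vᵢ≢0 vⱼ≢0 with i ≟ᶠ j
... | yes i≡j = i≡j
... | no  i≢j = ⊥-elim (vⱼ≢0 (begin
  v j                                ≡⟨ removeAt-punchOut v i≢j ⟨
  removeAt v i (punchOut i≢j)        ≡⟨ weight≡0⇒≡0 (removeAt v i) (weight-removeAt-≢0 v i vᵢ≢0 w≡1) (punchOut i≢j) ⟩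
  0ℤ                                 ∎))
  where open ≡-Reasoning

weight≡2⇒support⊆pair : ∀ {N} {v : Vector ℤ N} → weight v ≡ 2 →
                        ∃₂ λ a b → ∀ j → v j ≢ 0ℤ → j ≡ a ⊎ j ≡ b
weight≡2⇒support⊆pair {zero}  ()
weight≡2⇒support⊆pair {suc N} {v} w≡2 = a , punchIn a b , support
  where
  open ≡-Reasoning
  a : Fin (suc N)
  a = proj₁ (weight≡suc⇒∃≢0 v w≡2)
  vₐ≢0 : v a ≢ 0ℤ
  vₐ≢0 = proj₂ (weight≡suc⇒∃≢0 v w≡2)
  w′≡1 : weight (removeAt v a) ≡ 1
  w′≡1 = weight-removeAt-≢0 v a vₐ≢0 w≡2
  b : Fin N
  b = proj₁ (weight≡suc⇒∃≢0 (removeAt v a) w′≡1)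
  support : ∀ j → v j ≢ 0ℤ → j ≡ a ⊎ j ≡ punchIn a b
  support j vⱼ≢0 with j ≟ᶠ a
  ... | yes j≡a = inj₁ j≡a
  ... | no  j≢a = inj₂ (begin
    j                            ≡⟨ punchIn-punchOut a≢j ⟨
    punchIn a (punchOut a≢j)     ≡⟨ cong (punchIn a) (weight≡1⇒support-unique w′≡1
                                      (λ e → vⱼ≢0 (trans (sym (removeAt-punchOut v a≢j)) e))
                                      (proj₂ (weight≡suc⇒∃≢0 (removeAt v a) w′≡1))) ⟩
    punchIn a b                  ∎)
    where a≢j = j≢a ∘ sym

≗-removeAt⁻ : ∀ {A : Set} {N} {u v : Vector A (suc N)} i → u i ≡ v i → removeAt u i ≗ removeAt v i → u ≗ v
≗-removeAt⁻ {u = u} {v} i uᵢ≡vᵢ u′≗v′ j with i ≟ᶠ j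
... | yes refl = uᵢ≡vᵢ
... | no  i≢j  = begin
  u j                           ≡⟨ removeAt-punchOut u i≢j ⟨
  removeAt u i (punchOut i≢j)   ≡⟨ u′≗v′ (punchOut i≢j) ⟩
  removeAt v i (punchOut i≢j)   ≡⟨ removeAt-punchOut v i≢j ⟩
  v j                           ∎
  where open ≡-Reasoning

infix 7 _·_
_·_ : ∀ {N} → Vector ℤ N → Vector ℤ N → ℤ
u · v = ℤΣ.sum (λ j → u j ℤ.* v j)

·-removeAt : ∀ {N} (u v : Vector ℤ (suc N)) i → u · v ≡ u i ℤ.* v i ℤ.+ removeAt u i · removeAt v i
·-removeAt u v i = ℤΣ.sum-remove {i = i} (λ j → u j ℤ.* v j)

·-self : ∀ {N} (v : Vector ℤ N) → Trits v → v · v ≡ + weight v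
·-self {zero}  v _ = refl
·-self {suc N} v t = cong₂ ℤ._+_ (trit-square (t zero)) (·-self (Vector.tail v) (t ∘ suc))

·-scaleˡ : ∀ {N} c (u v w : Vector ℤ N) → (∀ j → u j ≡ c ℤ.* v j) → u · w ≡ c ℤ.* (v · w)
·-scaleˡ c u v w u≡cv = begin
  u · w                                   ≡⟨ ℤΣ.sum-cong-≗ (λ j → trans (cong (ℤ._* w j) (u≡cv j)) (ℤP.*-assoc c (v j) (w j))) ⟩
  ℤΣ.sum (λ j → c ℤ.* (v j ℤ.* w j))      ≡⟨ ℤΣ.*-distribˡ-sum c (λ j → v j ℤ.* w j) ⟨
  c ℤ.* (v · w)                           ∎
  where open ≡-Reasoning

·≢0⇒common-support : ∀ {N} (u v : Vector ℤ N) → u · v ≢ 0ℤ → ∃[ j ] u j ≢ 0ℤ × v j ≢ 0ℤ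
·≢0⇒common-support {zero}  u v u·v≢0 = ⊥-elim (u·v≢0 refl)
·≢0⇒common-support {suc N} u v u·v≢0 with u zero ℤ.* v zero ℤ.≟ 0ℤ
... | no u₀v₀≢0 =
  zero , (λ u₀≡0 → u₀v₀≢0 (trans (cong (ℤ._* v zero) u₀≡0) (ℤP.*-zeroˡ (v zero))))
       , (λ v₀≡0 → u₀v₀≢0 (trans (cong (u zero ℤ.*_) v₀≡0) (ℤP.*-zeroʳ (u zero))))
... | yes u₀v₀≡0
  with j , h ← ·≢0⇒common-support (Vector.tail u) (Vector.tail v) (λ e → u·v≢0 (cong₂ ℤ._+_ u₀v₀≡0 e))
  = suc j , h

length-filter+∁ : ∀ {A : Set} {P : A → Set} (P? : Decidable P) (L : List A) →
                  length (filter P? L) + length (filter (∁? P?) L) ≡ length L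
length-filter+∁ P? []      = refl
length-filter+∁ P? (x ∷ L) with P? x
... | yes _ = cong suc (length-filter+∁ P? L)
... | no  _ = trans (ℕP.+-suc _ _) (cong suc (length-filter+∁ P? L))

length-filter-split : ∀ {A : Set} {P : A → Set} (P? : Decidable P) (L : List A) {a b} →
                      length (filter P? L) ≤ a → length (filter (∁? P?) L) ≤ b → length L ≤ a + b
length-filter-split P? L ≤a ≤b = subst (_≤ _) (length-filter+∁ P? L) (ℕP.+-mono-≤ ≤a ≤b)

length≤0 : ∀ {A : Set} {L : List A} → (∀ {x} → ¬ x ∈ L) → length L ≤ 0
length≤0 {L = []}    _   = z≤n
length≤0 {L = x ∷ _} ∉L = ⊥-elim (∉L (here refl))

length≤1 : ∀ {A : Set} {L : List A} → Unique L → (∀ {x y} → x ∈ L → y ∈ L → x ≡ y) → length L ≤ 1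
length≤1 {L = []}        _                 _    = z≤n
length≤1 {L = _ ∷ []}    _                 _    = s≤s z≤n
length≤1 {L = _ ∷ _ ∷ _} ((x≢y ∷ _) ∷ _) all≡ = ⊥-elim (x≢y (all≡ (here refl) (there (here refl))))

-- Distinct k-sparse trit vectors, listed through a duplicate-free list of names and an injective
-- coding v, so that deleting coordinates changes v but not the list.
record SparseFamily {A : Set} {N : ℕ} (k : ℕ) (v : A → Vector ℤ N) (L : List A) : Set where
  field
    unique    : Unique L
    trits     : ∀ {x} → x ∈ L → Trits (v x)
    weight≡   : ∀ {x} → x ∈ L → weight (v x) ≡ k
    injective : ∀ {x y} → x ∈ L → y ∈ L → v x ≗ v y → x ≡ y

zero-at? : ∀ {A : Set} {N} (v : A → Vector ℤ N) i → Decidable (λ x → v x i ≡ 0ℤ)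
zero-at? v i x = v x i ℤ.≟ 0ℤ

PairwiseDot≢ : ∀ {A : Set} {N} → ℤ → (A → Vector ℤ N) → List A → Set
PairwiseDot≢ c v L = ∀ {x y} → x ∈ L → y ∈ L → v x · v y ≢ c

SignConsistent : ∀ {A : Set} {N} → (A → Vector ℤ N) → List A → Set
SignConsistent v L = ∀ {x y} j → x ∈ L → y ∈ L → v x j ≡ 1ℤ → v y j ≢ -1ℤ

module _ {A : Set} {N k} {v : A → Vector ℤ N} {L : List A} (F : SparseFamily k v L) where
  open SparseFamily F

  restrict : ∀ {L′} → Unique L′ → L′ ⊆ L → SparseFamily k v L′
  restrict unique′ L′⊆L = record
    { unique    = unique′
    ; trits     = λ x∈ → trits (L′⊆L x∈)
    ; weight≡   = λ x∈ → weight≡ (L′⊆L x∈)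
    ; injective = λ x∈ y∈ → injective (L′⊆L x∈) (L′⊆L y∈)
    }

  filter⁺ : ∀ {P : A → Set} (P? : Decidable P) → SparseFamily k v (filter P? L)
  filter⁺ P? = restrict (Unique.filter⁺ P? unique) (filter-⊆ P? L)

module _ {A : Set} {N k} {v : A → Vector ℤ (suc N)} {L : List A} (F : SparseFamily k v L) where
  open SparseFamily F

  removeAt⁺ : ∀ {k′} i → (∀ {x y} → x ∈ L → y ∈ L → v x i ≡ v y i) →
              (∀ {x} → x ∈ L → weight (removeAt (v x) i) ≡ k′) →
              SparseFamily k′ (λ x → removeAt (v x) i) L
  removeAt⁺ i agree weight′ = record
    { unique    = unique
    ; trits     = λ x∈ j → trits x∈ (punchIn i j)
    ; weight≡   = weight′
    ; injective = λ x∈ y∈ eq → injective x∈ y∈ (≗-removeAt⁻ i (agree x∈ y∈) eq)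
    }

  removeAt-zeros⁺ : ∀ i → (∀ {x} → x ∈ L → v x i ≡ 0ℤ) → SparseFamily k (λ x → removeAt (v x) i) L
  removeAt-zeros⁺ i vanish = removeAt⁺ i
    (λ x∈ y∈ → trans (vanish x∈) (sym (vanish y∈)))
    (λ {x} x∈ → trans (weight-removeAt-≡0 (v x) i (vanish x∈)) (weight≡ x∈))

module _ {A : Set} {N k} {v : A → Vector ℤ (suc N)} {L : List A} (F : SparseFamily (suc k) v L) where
  open SparseFamily F

  removeAt-agreeing⁺ : ∀ i → (∀ {x} → x ∈ L → v x i ≢ 0ℤ) → (∀ {x y} → x ∈ L → y ∈ L → v x i ≡ v y i) →
                       SparseFamily k (λ x → removeAt (v x) i) L
  removeAt-agreeing⁺ i nonzero agree = removeAt⁺ F i agree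
    (λ {x} x∈ → weight-removeAt-≢0 (v x) i (nonzero x∈) (weight≡ x∈))

signConsistent⇒length≤C : ∀ {A : Set} {N k} {v : A → Vector ℤ N} {L : List A} (D : Subset N) →
  SparseFamily k v L → (∀ {x} → x ∈ L → ∀ j → j ∈ₛ D → v x j ≡ 0ℤ) → SignConsistent v L →
  length L ≤ (N ∸ ∣ D ∣) C k
signConsistent⇒length≤C {k = zero} {v} _ F _ _ = length≤1 unique λ {x} {y} x∈ y∈ →
  injective x∈ y∈ (λ j → trans (weight≡0⇒≡0 (v x) (weight≡ x∈) j) (sym (weight≡0⇒≡0 (v y) (weight≡ y∈) j)))
  where open SparseFamily F
signConsistent⇒length≤C {k = suc k} [] F _ _ =
  length≤0 (λ x∈ → ℕP.0≢1+n (SparseFamily.weight≡ F x∈))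
signConsistent⇒length≤C (inside ∷ D) F vanish consistent =
  signConsistent⇒length≤C D (removeAt-zeros⁺ F zero (λ x∈ → vanish x∈ zero Vec.here))
    (λ x∈ j j∈D → vanish x∈ (suc j) (Vec.there j∈D)) (λ j → consistent (suc j))
signConsistent⇒length≤C {N = suc N} {suc k} {v} {L} (outside ∷ D) F vanish consistent = begin
  length L                                ≤⟨ length-filter-split P? L zero-head nonzero-head ⟩
  (N ∸ ∣ D ∣) C suc k + (N ∸ ∣ D ∣) C k   ≡⟨ ℕP.+-comm _ ((N ∸ ∣ D ∣) C k) ⟩
  (N ∸ ∣ D ∣) C k + (N ∸ ∣ D ∣) C suc k   ≡⟨ nCk+nC[k+1]≡[n+1]C[k+1] (N ∸ ∣ D ∣) k ⟩
  suc (N ∸ ∣ D ∣) C suc k                 ≡⟨ cong (_C suc k) (ℕP.+-∸-assoc 1 (∣p∣≤n D)) ⟨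
  (suc N ∸ ∣ D ∣) C suc k                 ∎
  where
  open SparseFamily F
  open ℕP.≤-Reasoning
  P? : Decidable (λ x → v x zero ≡ 0ℤ)
  P? = zero-at? v zero
  tail-bound : ∀ {k′ L′} → SparseFamily k′ (λ x → removeAt (v x) zero) L′ → L′ ⊆ L → length L′ ≤ (N ∸ ∣ D ∣) C k′
  tail-bound F′ L′⊆L = signConsistent⇒length≤C D F′
    (λ x∈ j j∈D → vanish (L′⊆L x∈) (suc j) (Vec.there j∈D)) (λ j x∈ y∈ → consistent (suc j) (L′⊆L x∈) (L′⊆L y∈))
  ∈L : filter P? L ⊆ L
  ∈L = filter-⊆ P? L
  ∈L′ : filter (∁? P?) L ⊆ L
  ∈L′ = filter-⊆ (∁? P?) L
  x₀≢0 : ∀ {x} → x ∈ filter (∁? P?) L → v x zero ≢ 0ℤ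
  x₀≢0 x∈ = proj₂ (∈-filter⁻ (∁? P?) {xs = L} x∈)
  zero-head : length (filter P? L) ≤ (N ∸ ∣ D ∣) C suc k
  zero-head = tail-bound (removeAt-zeros⁺ (filter⁺ F P?) zero (λ x∈ → proj₂ (∈-filter⁻ P? {xs = L} x∈))) ∈L
  nonzero-head : length (filter (∁? P?) L) ≤ (N ∸ ∣ D ∣) C k
  nonzero-head = tail-bound (removeAt-agreeing⁺ (filter⁺ F (∁? P?)) zero x₀≢0 λ x∈ y∈ →
    sign-agree (trits (∈L′ x∈) zero) (trits (∈L′ y∈) zero) (x₀≢0 x∈) (x₀≢0 y∈)
               (consistent zero (∈L′ x∈) (∈L′ y∈)) (consistent zero (∈L′ y∈) (∈L′ x∈))) ∈L′

weight₁⇒length≤2*dim : ∀ {A : Set} {N} {v : A → Vector ℤ N} {L : List A} → SparseFamily 1 v L → length L ≤ 2 * N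
weight₁⇒length≤2*dim {N = N} {v} {L} F = begin
  length L        ≤⟨ length-filter-split P? L (bound (filter⁺ F P?) positive) (bound (filter⁺ F (∁? P?)) negative) ⟩
  N C 1 + N C 1   ≡⟨ cong₂ _+_ (nC1≡n N) (nC1≡n N) ⟩
  N + N           ≡⟨ cong (_+_ N) (ℕP.+-identityʳ N) ⟨
  2 * N           ∎
  where
  open SparseFamily F
  open ℕP.≤-Reasoning
  P? : Decidable (λ x → ∃[ j ] v x j ≡ 1ℤ)
  P? x = any? (λ j → v x j ℤ.≟ 1ℤ)
  bound : ∀ {L′} → SparseFamily 1 v L′ → SignConsistent v L′ → length L′ ≤ N C 1
  bound F′ consistent = subst (λ d → _ ≤ (N ∸ d) C 1) (∣⊥∣≡0 N)
    (signConsistent⇒length≤C ∅ F′ (λ _ j j∈∅ → ⊥-elim (∉⊥ j∈∅)) consistent)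
  positive : SignConsistent v (filter P? L)
  positive {y = y} j _ y∈ _ yⱼ≡-1 =
    -1≢1 (trans (sym yⱼ≡-1) (trans (cong (v y) (weight≡1⇒support-unique (weight≡ y∈L) yⱼ≢0 yₖ≢0)) yₖ≡1))
    where
    y∈L : y ∈ L
    y∈L = proj₁ (∈-filter⁻ P? {xs = L} y∈)
    k : Fin N
    k = proj₁ (proj₂ (∈-filter⁻ P? {xs = L} y∈))
    yₖ≡1 : v y k ≡ 1ℤ
    yₖ≡1 = proj₂ (proj₂ (∈-filter⁻ P? {xs = L} y∈))
    -1≢1 : -1ℤ ≢ 1ℤ
    -1≢1 ()
    yⱼ≢0 : v y j ≢ 0ℤ
    yⱼ≢0 yⱼ≡0 with () ← trans (sym yⱼ≡-1) yⱼ≡0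
    yₖ≢0 : v y k ≢ 0ℤ
    yₖ≢0 yₖ≡0 with () ← trans (sym yₖ≡1) yₖ≡0
  negative : SignConsistent v (filter (∁? P?) L)
  negative j x∈ _ xⱼ≡1 _ = proj₂ (∈-filter⁻ (∁? P?) {xs = L} x∈) (j , xⱼ≡1)

pinned⇒length≤2*dim : ∀ {A : Set} {m} {v : A → Vector ℤ (suc m)} {L : List A} p →
  SparseFamily 2 v L → PairwiseDot≢ -[1+ 1 ] v L → (∀ {x} → x ∈ L → v x p ≢ 0ℤ) → length L ≤ 2 * m
pinned⇒length≤2*dim {A} {m} {v} {L} p F no-antipodal pinned = weight₁⇒length≤2*dim normalised
  where
  open SparseFamily F
  rest : A → Vector ℤ m
  rest x = removeAt (v x) p
  -- Scaling by the entry at p identifies x with -x, and two members with y = -x would have x·y = -2.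
  normalise : A → Vector ℤ m
  normalise x j = v x p ℤ.* rest x j
  square≡1 : ∀ {x} → x ∈ L → v x p ℤ.* v x p ≡ 1ℤ
  square≡1 x∈ = trit≢0⇒square≡1 (trits x∈ p) (pinned x∈)
  rest-weight≡1 : ∀ {x} → x ∈ L → weight (rest x) ≡ 1
  rest-weight≡1 {x} x∈ = weight-removeAt-≢0 (v x) p (pinned x∈) (weight≡ x∈)
  rest-rescaled : ∀ {x y} → x ∈ L → normalise x ≗ normalise y → ∀ j → rest x j ≡ (v x p ℤ.* v y p) ℤ.* rest y j
  rest-rescaled {x} {y} x∈ eq j = *-cancel-unit (v x p) (v y p) (rest x j) (rest y j) (square≡1 x∈) (eq j)
  injective′ : ∀ {x y} → x ∈ L → y ∈ L → normalise x ≗ normalise y → x ≡ y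
  injective′ {x} {y} x∈ y∈ eq with unit-product (trits x∈ p) (trits y∈ p) (pinned x∈) (pinned y∈)
  ... | inj₁ xₚ≡yₚ = injective x∈ y∈ (≗-removeAt⁻ p xₚ≡yₚ λ j → begin
    rest x j                            ≡⟨ rest-rescaled x∈ eq j ⟩
    (v x p ℤ.* v y p) ℤ.* rest y j      ≡⟨ cong (λ s → (s ℤ.* v y p) ℤ.* rest y j) xₚ≡yₚ ⟩
    (v y p ℤ.* v y p) ℤ.* rest y j      ≡⟨ cong (ℤ._* rest y j) (square≡1 y∈) ⟩
    1ℤ ℤ.* rest y j                     ≡⟨ ℤP.*-identityˡ (rest y j) ⟩
    rest y j                            ∎)
    where open ≡-Reasoning
  ... | inj₂ xₚyₚ≡-1 = ⊥-elim (no-antipodal x∈ y∈ (begin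
    v x · v y                           ≡⟨ ·-removeAt (v x) (v y) p ⟩
    v x p ℤ.* v y p ℤ.+ rest x · rest y ≡⟨ cong₂ ℤ._+_ xₚyₚ≡-1 (·-scaleˡ -1ℤ (rest x) (rest y) (rest y)
                                             (λ j → trans (rest-rescaled x∈ eq j) (cong (ℤ._* rest y j) xₚyₚ≡-1))) ⟩
    -1ℤ ℤ.+ -1ℤ ℤ.* (rest y · rest y)   ≡⟨ cong (λ z → -1ℤ ℤ.+ -1ℤ ℤ.* z) (·-self (rest y) (λ j → trits y∈ (punchIn p j))) ⟩
    -1ℤ ℤ.+ -1ℤ ℤ.* + weight (rest y)   ≡⟨ cong (λ k → -1ℤ ℤ.+ -1ℤ ℤ.* + k) (rest-weight≡1 y∈) ⟩
    -[1+ 1 ]                            ∎))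
    where open ≡-Reasoning
  normalised : SparseFamily 1 normalise L
  normalised = record
    { unique    = unique
    ; trits     = λ x∈ j → trit-* (trits x∈ p) (trits x∈ (punchIn p j))
    ; weight≡   = λ {x} x∈ → trans (ℕΣ.sum-cong-≗ (λ j → isNonzero-*-unit (rest x j) (trits x∈ p) (pinned x∈)))
                                    (rest-weight≡1 x∈)
    ; injective = injective′
    }

pinnedAtEither⇒length≤4*dim : ∀ {A : Set} {m} {v : A → Vector ℤ (suc m)} {L : List A} a b →
  SparseFamily 2 v L → PairwiseDot≢ -[1+ 1 ] v L → (∀ {x} → x ∈ L → v x a ≢ 0ℤ ⊎ v x b ≢ 0ℤ) →
  length L ≤ 4 * m
pinnedAtEither⇒length≤4*dim {m = m} {v} {L} a b F no-antipodal pinned = begin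
  length L       ≤⟨ length-filter-split P? L
                      (pinned⇒length≤2*dim b (filter⁺ F P?) (no-antipodal-on ∈L) pinned-b)
                      (pinned⇒length≤2*dim a (filter⁺ F (∁? P?)) (no-antipodal-on ∈L′) pinned-a) ⟩
  2 * m + 2 * m  ≡⟨ ℕP.*-distribʳ-+ m 2 2 ⟨
  4 * m          ∎
  where
  open ℕP.≤-Reasoning
  P? : Decidable (λ x → v x a ≡ 0ℤ)
  P? = zero-at? v a
  ∈L : filter P? L ⊆ L
  ∈L = filter-⊆ P? L
  ∈L′ : filter (∁? P?) L ⊆ L
  ∈L′ = filter-⊆ (∁? P?) L
  no-antipodal-on : ∀ {L′} → L′ ⊆ L → PairwiseDot≢ -[1+ 1 ] v L′
  no-antipodal-on L′⊆L x∈ y∈ = no-antipodal (L′⊆L x∈) (L′⊆L y∈)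
  pinned-a : ∀ {x} → x ∈ filter (∁? P?) L → v x a ≢ 0ℤ
  pinned-a x∈ = proj₂ (∈-filter⁻ (∁? P?) {xs = L} x∈)
  pinned-b : ∀ {x} → x ∈ filter P? L → v x b ≢ 0ℤ
  pinned-b x∈ with pinned (∈L x∈)
  ... | inj₁ xₐ≢0 = ⊥-elim (xₐ≢0 (proj₂ (∈-filter⁻ P? {xs = L} x∈)))
  ... | inj₂ x_b≢0 = x_b≢0

nonzeros≡weight : ∀ {n} (v : Vec ℤ n) → nonzeros v ≡ weight (lookup v)
nonzeros≡weight []               = refl
nonzeros≡weight (+ zero    ∷ v) = nonzeros≡weight v
nonzeros≡weight (+ suc _   ∷ v) = cong suc (nonzeros≡weight v)
nonzeros≡weight (-[1+ _ ] ∷ v) = cong suc (nonzeros≡weight v)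

dot≡· : ∀ {n} (u v : Vec ℤ n) → dot u v ≡ lookup u · lookup v
dot≡· []      []      = refl
dot≡· (x ∷ u) (y ∷ v) = cong (λ z → x ℤ.* y ℤ.+ z) (dot≡· u v)

lookup-injective : ∀ {A : Set} {n} (u v : Vec A n) → lookup u ≗ lookup v → u ≡ v
lookup-injective u v u≗v = trans (sym (tabulate∘lookup u)) (trans (tabulate-cong u≗v) (tabulate∘lookup v))

length≤touching+vanishing : ∀ {A : Set} {n} (v : A → Vector ℤ n) B (ds : List (Fin n)) {L : List A} → Unique L →
  (∀ {i} → i ∈ ds → ∀ {L′} → Unique L′ → L′ ⊆ L → (∀ {x} → x ∈ L′ → v x i ≢ 0ℤ) → length L′ ≤ B) →
  ∃[ L′ ] Unique L′ × L′ ⊆ L × (∀ {x i} → x ∈ L′ → i ∈ ds → v x i ≡ 0ℤ) × length L ≤ length ds * B + length L′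
length≤touching+vanishing v B []       {L} unique _ = L , unique , (λ x∈ → x∈) , (λ _ ()) , ℕP.≤-refl
length≤touching+vanishing v B (i ∷ ds) {L} unique touching≤B =
  let L′ , unique′ , L′⊆ , vanish , length≤ =
        length≤touching+vanishing v B ds (Unique.filter⁺ P? unique)
          (λ i∈ unique″ L″⊆ → touching≤B (there i∈) unique″ (λ x∈ → ∈L (L″⊆ x∈)))
  in L′ , unique′ , (λ x∈ → ∈L (L′⊆ x∈))
   , (λ { x∈ (here refl) → xᵢ≡0 (L′⊆ x∈) ; x∈ (there j∈) → vanish x∈ j∈ })
   , (begin
       length L                           ≤⟨ length-filter-split P? L length≤ touching-i ⟩
       length ds * B + length L′ + B      ≡⟨ ℕP.+-comm (length ds * B + length L′) B ⟩
       B + (length ds * B + length L′)    ≡⟨ ℕP.+-assoc B (length ds * B) (length L′) ⟨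
       suc (length ds) * B + length L′    ∎)
  where
  open ℕP.≤-Reasoning
  P? : Decidable (λ x → v x i ≡ 0ℤ)
  P? = zero-at? v i
  ∈L : filter P? L ⊆ L
  ∈L = filter-⊆ P? L
  xᵢ≡0 : ∀ {x} → x ∈ filter P? L → v x i ≡ 0ℤ
  xᵢ≡0 x∈ = proj₂ (∈-filter⁻ P? {xs = L} x∈)
  touching-i : length (filter (∁? P?) L) ≤ B
  touching-i = touching≤B (here refl) (Unique.filter⁺ (∁? P?) unique)
    (filter-⊆ (∁? P?) L) (λ x∈ → proj₂ (∈-filter⁻ (∁? P?) {xs = L} x∈))

members : ∀ {n} → Subset n → List (Fin n)
members []            = []
members (inside ∷ p)  = zero ∷ List.map suc (members p)
members (outside ∷ p) = List.map suc (members p)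

length-members : ∀ {n} (p : Subset n) → length (members p) ≡ ∣ p ∣
length-members []            = refl
length-members (inside ∷ p)  = cong suc (trans (length-map suc (members p)) (length-members p))
length-members (outside ∷ p) = trans (length-map suc (members p)) (length-members p)

∈-members⁺ : ∀ {n} {p : Subset n} {i} → i ∈ₛ p → i ∈ members p
∈-members⁺ {p = inside ∷ p}  Vec.here        = here refl
∈-members⁺ {p = inside ∷ p}  (Vec.there i∈) = there (∈-map⁺ suc (∈-members⁺ i∈))
∈-members⁺ {p = outside ∷ p} (Vec.there i∈) = ∈-map⁺ suc (∈-members⁺ i∈)

∈-members⁻ : ∀ {n} {p : Subset n} {i} → i ∈ members p → i ∈ₛ p
∈-members⁻ {p = inside ∷ p} (here refl) = Vec.here
∈-members⁻ {p = inside ∷ p} (there i∈) with _ , j∈ , refl ← ∈-map⁻ suc i∈ = Vec.there (∈-members⁻ j∈)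
∈-members⁻ {p = outside ∷ p} i∈        with _ , j∈ , refl ← ∈-map⁻ suc i∈ = Vec.there (∈-members⁻ j∈)

module _ {m} {I : List (Vec ℤ (2 + m))} (independent : IsIndependentSet I) where

  vertices : SparseFamily 3 lookup I
  vertices = record
    { unique    = proj₁ independent
    ; trits     = λ x∈ → lookup⁺ (proj₁ (proj₁ (proj₂ independent) x∈))
    ; weight≡   = λ {x} x∈ → trans (sym (nonzeros≡weight x)) (proj₂ (proj₁ (proj₂ independent) x∈))
    ; injective = λ {x} {y} _ _ → lookup-injective x y
    }

  nonadjacent : ∀ {x y} → x ∈ I → y ∈ I → lookup x · lookup y ≢ -1ℤ
  nonadjacent {x} {y} x∈ y∈ x·y≡-1 = proj₂ (proj₂ independent) x∈ y∈ (trans (dot≡· x y) x·y≡-1)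

  signed⇒length≤4*m : ∀ i s {r L} → s ℤ.* s ≡ 1ℤ → r ∈ I → s ℤ.* lookup r i ≡ -1ℤ →
                     Unique L → L ⊆ I → (∀ {x} → x ∈ L → lookup x i ≡ s) → length L ≤ 4 * m
  signed⇒length≤4*m i s {r} {L} s²≡1 r∈ srᵢ≡-1 unique L⊆I xᵢ≡s =
    pinnedAtEither⇒length≤4*dim a b links no-antipodal meets-r
    where
    rest : Vec ℤ (2 + m) → Vector ℤ (suc m)
    rest x = removeAt (lookup x) i
    s≢0 : s ≢ 0ℤ
    s≢0 = proj₁ (*≡⇒≢0 (λ ()) srᵢ≡-1)
    rᵢ≢0 : lookup r i ≢ 0ℤ
    rᵢ≢0 = proj₂ (*≡⇒≢0 {s} (λ ()) srᵢ≡-1)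
    links : SparseFamily 2 rest L
    links = removeAt-agreeing⁺ (restrict vertices unique L⊆I) i
      (λ x∈ xᵢ≡0 → s≢0 (trans (sym (xᵢ≡s x∈)) xᵢ≡0))
      (λ x∈ y∈ → trans (xᵢ≡s x∈) (sym (xᵢ≡s y∈)))
    r′-support : ∃₂ λ a b → ∀ j → rest r j ≢ 0ℤ → j ≡ a ⊎ j ≡ b
    r′-support = weight≡2⇒support⊆pair (weight-removeAt-≢0 (lookup r) i rᵢ≢0 (SparseFamily.weight≡ vertices r∈))
    a b : Fin (suc m)
    a = proj₁ r′-support
    b = proj₁ (proj₂ r′-support)
    no-antipodal : PairwiseDot≢ -[1+ 1 ] rest L
    no-antipodal {x} {y} x∈ y∈ x′·y′≡-2 = nonadjacent (L⊆I x∈) (L⊆I y∈) (begin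
      lookup x · lookup y                            ≡⟨ ·-removeAt (lookup x) (lookup y) i ⟩
      lookup x i ℤ.* lookup y i ℤ.+ rest x · rest y  ≡⟨ cong₂ ℤ._+_ (cong₂ ℤ._*_ (xᵢ≡s x∈) (xᵢ≡s y∈)) x′·y′≡-2 ⟩
      s ℤ.* s ℤ.+ -[1+ 1 ]                           ≡⟨ cong (ℤ._+ -[1+ 1 ]) s²≡1 ⟩
      -1ℤ                                            ∎)
      where open ≡-Reasoning
    x′·r′≢0 : ∀ {x} → x ∈ L → rest x · rest r ≢ 0ℤ
    x′·r′≢0 {x} x∈ x′·r′≡0 = nonadjacent (L⊆I x∈) r∈ (begin
      lookup x · lookup r                            ≡⟨ ·-removeAt (lookup x) (lookup r) i ⟩
      lookup x i ℤ.* lookup r i ℤ.+ rest x · rest r  ≡⟨ cong₂ ℤ._+_ (cong (ℤ._* lookup r i) (xᵢ≡s x∈)) x′·r′≡0 ⟩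
      s ℤ.* lookup r i ℤ.+ 0ℤ                        ≡⟨ cong (ℤ._+ 0ℤ) srᵢ≡-1 ⟩
      -1ℤ                                            ∎)
      where open ≡-Reasoning
    meets-r : ∀ {x} → x ∈ L → rest x a ≢ 0ℤ ⊎ rest x b ≢ 0ℤ
    meets-r {x} x∈
      with j , x′ⱼ≢0 , r′ⱼ≢0 ← ·≢0⇒common-support (rest x) (rest r) (x′·r′≢0 x∈)
      with proj₂ (proj₂ r′-support) j r′ⱼ≢0
    ... | inj₁ refl = inj₁ x′ⱼ≢0
    ... | inj₂ refl = inj₂ x′ⱼ≢0

  touching⇒length≤8*m : ∀ i → Diverse I i → ∀ {L} → Unique L → L ⊆ I → (∀ {x} → x ∈ L → lookup x i ≢ 0ℤ) →
                       length L ≤ 8 * m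
  touching⇒length≤8*m i (u , w , u∈ , w∈ , uᵢ≡1 , wᵢ≡-1) {L} unique L⊆I touching = begin
    length L       ≤⟨ length-filter-split P? L
                        (signed⇒length≤4*m i 1ℤ refl w∈ (cong (1ℤ ℤ.*_) wᵢ≡-1) (Unique.filter⁺ P? unique)
                          (λ x∈ → L⊆I (∈L x∈)) (λ x∈ → proj₂ (∈-filter⁻ P? {xs = L} x∈)))
                        (signed⇒length≤4*m i -1ℤ refl u∈ (cong (-1ℤ ℤ.*_) uᵢ≡1) (Unique.filter⁺ (∁? P?) unique)
                          (λ x∈ → L⊆I (∈L′ x∈)) xᵢ≡-1) ⟩
    4 * m + 4 * m  ≡⟨ ℕP.*-distribʳ-+ m 4 4 ⟨
    8 * m          ∎
    where
    open ℕP.≤-Reasoning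
    P? : Decidable (λ x → lookup x i ≡ 1ℤ)
    P? x = lookup x i ℤ.≟ 1ℤ
    ∈L : filter P? L ⊆ L
    ∈L = filter-⊆ P? L
    ∈L′ : filter (∁? P?) L ⊆ L
    ∈L′ = filter-⊆ (∁? P?) L
    xᵢ≡-1 : ∀ {x} → x ∈ filter (∁? P?) L → lookup x i ≡ -1ℤ
    xᵢ≡-1 x∈ = trit≢0,1⇒≡-1 (SparseFamily.trits vertices (L⊆I (∈L′ x∈)) i) (touching (∈L′ x∈))
                 (proj₂ (∈-filter⁻ (∁? P?) {xs = L} x∈))

  vanishing⇒length≤C : (D : Subset (2 + m)) → (∀ {i} → Diverse I i → i ∈ₛ D) → ∀ {L} → Unique L → L ⊆ I →
                       (∀ {x i} → x ∈ L → i ∈ₛ D → lookup x i ≡ 0ℤ) → length L ≤ (suc (suc m) ∸ ∣ D ∣) C 3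
  vanishing⇒length≤C D diverse⇒∈D {L} unique L⊆I vanish =
    signConsistent⇒length≤C D (restrict vertices unique L⊆I) (λ x∈ _ → vanish x∈) consistent
    where
    consistent : SignConsistent lookup L
    consistent {x} {y} j x∈ y∈ xⱼ≡1 yⱼ≡-1 with () ←
      trans (sym xⱼ≡1) (vanish x∈ (diverse⇒∈D (x , y , L⊆I x∈ , L⊆I y∈ , xⱼ≡1 , yⱼ≡-1)))

lemma1 : (n : ℕ) → 3 ≤ n → (I : List (Vec ℤ n)) → IsIndependentSet I →
         (t : ℕ) → (D : Subset n) →
         (∀ i → (i ∈ₛ D → Diverse I i) × (Diverse I i → i ∈ₛ D)) → ∣ D ∣ ≡ t →
         length I ≤ 8 * t * (n ∸ 2) + (n ∸ t) C 3
lemma1 (suc (suc m)) (s≤s (s≤s _)) I independent t D diverse⇔∈D refl =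
  let L′ , unique′ , L′⊆I , vanish , length-I≤ =
        length≤touching+vanishing lookup (8 * m) (members D) (proj₁ independent)
          (λ i∈ → touching⇒length≤8*m independent _ (proj₁ (diverse⇔∈D _) (∈-members⁻ i∈)))
  in begin
    length I                                      ≤⟨ length-I≤ ⟩
    length (members D) * (8 * m) + length L′      ≡⟨ cong (λ k → k * (8 * m) + length L′) (length-members D) ⟩
    ∣ D ∣ * (8 * m) + length L′                   ≤⟨ ℕP.+-monoʳ-≤ (∣ D ∣ * (8 * m))
      (vanishing⇒length≤C independent D (proj₂ (diverse⇔∈D _)) unique′ L′⊆I (λ x∈ i∈D → vanish x∈ (∈-members⁺ i∈D))) ⟩
    ∣ D ∣ * (8 * m) + c                           ≡⟨ cong (_+ c) (ℕP.*-assoc ∣ D ∣ 8 m) ⟨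
    ∣ D ∣ * 8 * m + c                             ≡⟨ cong (λ k → k * m + c) (ℕP.*-comm ∣ D ∣ 8) ⟩
    8 * ∣ D ∣ * m + c                             ∎
  where
  open ℕP.≤-Reasoning
  c : ℕ
  c = (suc (suc m) ∸ ∣ D ∣) C 3
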